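{- Let $\langle B,f,g\rangle$ be a Boolean algebra with two modal operators. Then $f(x)+g(x)=1$ for all $x\neq0$ (i.e. $\langle B,f,g\rangle$ is a discriminator decomposition algebra) if and only if $R_f\cup R_g=\mathrm{Ult}(B)^2$.
   Context: A modal operator is $f:B\to B$ with $f(0)=0$, $f(x+y)=f(x)+f(y)$. $\mathrm{Ult}(B)$ is the set of ultrafilters of $B$. The canonical relation of $f$ is defined on $\mathrm{Ult}(B)$ by $F R_f G$ iff $\{f(a):a\in G\}\subseteq F$. -}

module Defs where

open import Level using (Level; _⊔_; suc)
open import Data.Product using (Σ; _×_)
open import Data.Sum using (_⊎_)
open import Relation.Nullary using (¬_)
open import Algebra.Lattice.Bundles using (BooleanAlgebra)

module _ {c ℓ : Level} (B : BooleanAlgebra c ℓ) where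
  open BooleanAlgebra B renaming (¬_ to -_)

  record IsModalOperator (f : Carrier → Carrier) : Set (c ⊔ ℓ) where
    field
      cong    : ∀ {x y} → x ≈ y → f x ≈ f y
      zero    : f ⊥ ≈ ⊥
      additive : ∀ x y → f (x ∨ y) ≈ f x ∨ f y

  record IsUltrafilter (U : Carrier → Set (c ⊔ ℓ)) : Set (c ⊔ ℓ) where
    field
      respects : ∀ {x y} → x ≈ y → U x → U y
      top      : U ⊤
      proper   : ¬ U ⊥
      meet     : ∀ {x y} → U x → U y → U (x ∧ y)
      upward   : ∀ {x y} → U x → x ∨ y ≈ y → U y
      ultra    : ∀ x → U x ⊎ U (- x)

  Ult : Set (suc (c ⊔ ℓ))
  Ult = Σ (Carrier → Set (c ⊔ ℓ)) IsUltrafilter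

  _∈_ : Carrier → Ult → Set (c ⊔ ℓ)
  a ∈ (U Data.Product., _) = U a

  R : (Carrier → Carrier) → Ult → Ult → Set (c ⊔ ℓ)
  R f F G = ∀ a → a ∈ G → f a ∈ F

  IsDDA : (Carrier → Carrier) → (Carrier → Carrier) → Set (c ⊔ ℓ)
  IsDDA f g = ∀ x → ¬ (x ≈ ⊥) → f x ∨ g x ≈ ⊤

  UnionIsFull : (Carrier → Carrier) → (Carrier → Carrier) → Set (suc (c ⊔ ℓ))
  UnionIsFull f g = ∀ (F G : Ult) → R f F G ⊎ R g F G

-- Ambient classical metatheory (ZFC): the ultrafilter lemma (BPI),
-- in the form "every nonzero element lies in some ultrafilter".
UltrafilterLemma : (c ℓ : Level) → Set (suc (c ⊔ ℓ))
UltrafilterLemma c ℓ = (B : BooleanAlgebra c ℓ) →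
  let open BooleanAlgebra B using (_≈_; ⊥) in
  ∀ a → ¬ (a ≈ ⊥) → Σ (Ult B) (λ U → _∈_ B a U)

-- If f x ∨ g x = ⊤ for every x ≠ ⊥ and neither F R_f G nor F R_g G, then there are a, b ∈ G
-- with f a, g b ∉ F; for the nonzero c = a ∧ b ∈ G monotonicity gives f c, g c ∉ F, so the
-- ultrafilter F misses f c ∨ g c = ⊤.  Conversely, if f x ∨ g x ≠ ⊤ for some x ≠ ⊥, take an
-- ultrafilter F ∋ -(f x ∨ g x) and an ultrafilter G ∋ x: whichever of R_f, R_g relates F to G
-- puts f x or g x, hence f x ∨ g x, into F as well.
module Submission where

open import Defs
open import Level using (Level; _⊔_; lift; lower)
open import Function.Base using (_∘_; id)
open import Function.Bundles using (_⇔_; mk⇔)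
open import Axiom.ExcludedMiddle using (ExcludedMiddle)
open import Axiom.DoubleNegationElimination using (DoubleNegationElimination; em⇒dne)
open import Algebra.Lattice.Bundles using (BooleanAlgebra)
open import Data.Product using (Σ-syntax; _×_; _,_; proj₂)
open import Data.Sum using (inj₁; inj₂; [_,_])
open import Relation.Nullary using (¬_; contradiction)
import Algebra.Lattice.Properties.BooleanAlgebra as BooleanAlgebraProperties
import Relation.Binary.Reasoning.Setoid as SetoidReasoning

module _ {c ℓ : Level} (B : BooleanAlgebra c ℓ) where
  open BooleanAlgebra B renaming (¬_ to -_)
  open BooleanAlgebraProperties B using (∨-idem; deMorgan₂; ¬-involutive; ¬⊥≈⊤)
  open SetoidReasoning setoid

  infix 4 _≤_ _∈′_ _∉′_
  _≤_ : Carrier → Carrier → Set ℓ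
  x ≤ y = x ∨ y ≈ y

  x∧y≤x : ∀ x y → x ∧ y ≤ x
  x∧y≤x x y = trans (∨-comm (x ∧ y) x) (∨-absorbs-∧ x y)

  x∧y≤y : ∀ x y → x ∧ y ≤ y
  x∧y≤y x y = trans (∨-congʳ (∧-comm x y)) (x∧y≤x y x)

  x≤x∨y : ∀ x y → x ≤ x ∨ y
  x≤x∨y x y = trans (sym (∨-assoc x x y)) (∨-congʳ (∨-idem x))

  y≤x∨y : ∀ x y → y ≤ x ∨ y
  y≤x∨y x y = trans (∨-congˡ (∨-comm x y)) (trans (x≤x∨y y x) (∨-comm y x))

  -x≈⊥⇒x≈⊤ : ∀ {x} → - x ≈ ⊥ → x ≈ ⊤
  -x≈⊥⇒x≈⊤ {x} -x≈⊥ = begin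
    x      ≈⟨ ¬-involutive x ⟨
    - - x  ≈⟨ ¬-cong -x≈⊥ ⟩
    - ⊥    ≈⟨ ¬⊥≈⊤ ⟩
    ⊤      ∎

  modal-monotone : ∀ {h} → IsModalOperator B h → ∀ {x y} → x ≤ y → h x ≤ h y
  modal-monotone {h} mh {x} {y} x≤y = begin
    h x ∨ h y  ≈⟨ IsModalOperator.additive mh x y ⟨
    h (x ∨ y)  ≈⟨ IsModalOperator.cong mh x≤y ⟩
    h y        ∎

  _∈′_ : Carrier → Ult B → Set (c ⊔ ℓ)
  x ∈′ U = _∈_ B x U

  _∉′_ : Carrier → Ult B → Set (c ⊔ ℓ)
  x ∉′ U = ¬ (x ∈′ U)

  module _ (U : Ult B) where
    open IsUltrafilter (proj₂ U)

    ≈⊤⇒∈ : ∀ {x} → x ≈ ⊤ → x ∈′ U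
    ≈⊤⇒∈ x≈⊤ = respects (sym x≈⊤) top

    ∉-antitone : ∀ {x y} → x ≤ y → y ∉′ U → x ∉′ U
    ∉-antitone x≤y y∉U x∈U = y∉U (upward x∈U x≤y)

    ∈⇒≉⊥ : ∀ {x} → x ∈′ U → ¬ (x ≈ ⊥)
    ∈⇒≉⊥ x∈U x≈⊥ = proper (respects x≈⊥ x∈U)

    -∈⇒∉ : ∀ {x} → - x ∈′ U → x ∉′ U
    -∈⇒∉ -x∈U x∈U = proper (respects (∧-complementʳ _) (meet x∈U -x∈U))

    ∉⇒-∈ : ∀ {x} → x ∉′ U → - x ∈′ U
    ∉⇒-∈ {x} x∉U = [ (λ x∈U → contradiction x∈U x∉U) , id ] (ultra x)

    ∨-∉ : ∀ {x y} → x ∉′ U → y ∉′ U → x ∨ y ∉′ U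
    ∨-∉ {x} {y} x∉U y∉U x∨y∈U =
      -∈⇒∉ (respects (sym (deMorgan₂ x y)) (meet (∉⇒-∈ x∉U) (∉⇒-∈ y∉U))) x∨y∈U

  module _ (dne : DoubleNegationElimination (c ⊔ ℓ)) where

    ¬R⇒counterexample : ∀ h F G → ¬ R B h F G → Σ[ a ∈ Carrier ] a ∈′ G × h a ∉′ F
    ¬R⇒counterexample h F G ¬FRG =
      dne λ noCounterexample → ¬FRG λ a a∈G → dne λ ha∉F → noCounterexample (a , a∈G , ha∉F)

    module _ {f g} (mf : IsModalOperator B f) (mg : IsModalOperator B g) where

      isDDA⇒unionIsFull : IsDDA B f g → UnionIsFull B f g
      isDDA⇒unionIsFull dda F G = dne λ ¬FRG →
        let a , a∈G , fa∉F = ¬R⇒counterexample f F G (¬FRG ∘ inj₁)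
            b , b∈G , gb∉F = ¬R⇒counterexample g F G (¬FRG ∘ inj₂)
            a∧b∈G = IsUltrafilter.meet (proj₂ G) a∈G b∈G
            f[a∧b]∉F = ∉-antitone F (modal-monotone mf (x∧y≤x a b)) fa∉F
            g[a∧b]∉F = ∉-antitone F (modal-monotone mg (x∧y≤y a b)) gb∉F
        in ∨-∉ F f[a∧b]∉F g[a∧b]∉F (≈⊤⇒∈ F (dda (a ∧ b) (∈⇒≉⊥ G a∧b∈G)))

      unionIsFull⇒isDDA : UltrafilterLemma c ℓ → UnionIsFull B f g → IsDDA B f g
      unionIsFull⇒isDDA ultrafilterLemma full x x≉⊥ = lower (dne λ fx∨gx≉⊤ →
        let F , -[fx∨gx]∈F = ultrafilterLemma B (- (f x ∨ g x)) (fx∨gx≉⊤ ∘ lift {ℓ = c} ∘ -x≈⊥⇒x≈⊤)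
            G , x∈G = ultrafilterLemma B x x≉⊥
            fx∨gx∉F = -∈⇒∉ F -[fx∨gx]∈F
        in [ (λ FRfG → ∉-antitone F (x≤x∨y (f x) (g x)) fx∨gx∉F (FRfG x x∈G))
           , (λ FRgG → ∉-antitone F (y≤x∨y (f x) (g x)) fx∨gx∉F (FRgG x x∈G))
           ] (full F G))

mainTheorem12 : {c ℓ : Level} → ExcludedMiddle (c ⊔ ℓ) → UltrafilterLemma c ℓ →
                (B : BooleanAlgebra c ℓ) → (f g : BooleanAlgebra.Carrier B → BooleanAlgebra.Carrier B) →
                IsModalOperator B f → IsModalOperator B g →
                IsDDA B f g ⇔ UnionIsFull B f g
mainTheorem12 em ultrafilterLemma B f g mf mg =
  mk⇔ (isDDA⇒unionIsFull B dne mf mg) (unionIsFull⇒isDDA B dne mf mg ultrafilterLemma)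
  where dne = em⇒dne em
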